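{- Let $p:\mathcal E\to\mathcal I$ be a monoidal closed bifibration and let $\circledast:A\otimes B\to C$ be an expression of $\mathcal I$. For $S\sqsubset A$, $T\sqsubset B$, $U\sqsubset C$ define $$S*T:=\circledast_!(S\otimes T)\sqsubset C,\qquad S\backslash_{\circledast}U:=\lambda(\circledast)^*(S\backslash U)\sqsubset B,\qquad U/_{\circledast}T:=\rho(\circledast)^*(U/T)\sqsubset A,$$ where $\lambda(\circledast):B\to A\backslash C$ and $\rho(\circledast):A\to C/B$. Then there is a three-way adjunction: for all such $S,T,U$ there are bijections between derivations of $S\le U/_{\circledast}T$, derivations of $S*T\le U$, and derivations of $T\le S\backslash_{\circledast}U$.
   Context: A type refinement system is a functor $p:\mathcal E\to\mathcal I$; objects/morphisms of $\mathcal I$ are i-types/expressions, of $\mathcal E$ are e-types/derivations. $S\sqsubset A$ means $p(S)=A$. A derivation of $S\Rightarrow_f T$ is a morphism $\alpha:S\to T$ in $\mathcal E$ with $p(\alpha)=f$; $S\le T$ denotes $S\Rightarrow_{\mathrm{id}}T$. For $f:A\to B$: the pullback $f^*T$ of $T\sqsubset B$ is an e-type refining $A$ with a cartesian derivation of $f^*T\Rightarrow_f T$; the pushforward $f_!S$ of $S\sqsubset A$ is an e-type refining $B$ with an opcartesian derivation of $S\Rightarrow_f f_!S$. $\mathcal I$ is monoidal closed with product $\otimes$, left residuals $A\backslash C$ (evaluation $\mathrm{ev}^l:A\otimes(A\backslash C)\to C$, currying bijection $\lambda:\mathrm{Hom}(A\otimes X,C)\cong\mathrm{Hom}(X,A\backslash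 C)$) and right residuals $C/B$ (evaluation $\mathrm{ev}^r:(C/B)\otimes B\to C$, currying bijection $\rho:\mathrm{Hom}(X\otimes B,C)\cong\mathrm{Hom}(X,C/B)$), with the usual $\beta\eta$ equations. A monoidal closed bifibration is a strong monoidal functor $p$ (with $S\otimes T\sqsubset A\otimes B$ for $S\sqsubset A,T\sqsubset B$) having all pullbacks and pushforwards, preserved by $\otimes$ up to vertical isomorphism, and having for $S\sqsubset A$, $T\sqsubset B$, $U\sqsubset C$ e-types $S\backslash U\sqsubset A\backslash C$ and $U/T\sqsubset C/B$ with evaluation derivations over $\mathrm{ev}^l,\mathrm{ev}^r$ and currying operations on derivations over $\lambda,\rho$ satisfying the $\beta\eta$ equations. -}

module Defs where

open import Level using (Level; _⊔_) renaming (suc to lsuc)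
open import Relation.Binary.PropositionalEquality using (_≡_; subst)

PathOver : ∀ {a b} {X : Set a} (P : X → Set b) {x y : X} → x ≡ y → P x → P y → Set b
PathOver P e u v = subst P e u ≡ v

record Category (o h : Level) : Set (lsuc (o ⊔ h)) where
  infixr 9 _∘_
  field
    Ob    : Set o
    Hom   : Ob → Ob → Set h
    id    : ∀ {A} → Hom A A
    _∘_   : ∀ {A B C} → Hom B C → Hom A B → Hom A C
    idˡ   : ∀ {A B} (f : Hom A B) → id ∘ f ≡ f
    idʳ   : ∀ {A B} (f : Hom A B) → f ∘ id ≡ f
    assoc : ∀ {A B C D} (h : Hom C D) (g : Hom B C) (f : Hom A B) →
            (h ∘ g) ∘ f ≡ h ∘ (g ∘ f)

record ClosedTensor {o h : Level} (I : Category o h) : Set (o ⊔ h) where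
  open Category I
  infixr 10 _⊗_ _⊗₁_
  field
    _⊗_   : Ob → Ob → Ob
    _⊗₁_  : ∀ {A A′ B B′} → Hom A A′ → Hom B B′ → Hom (A ⊗ B) (A′ ⊗ B′)
    ⊗-id  : ∀ {A B} → id {A} ⊗₁ id {B} ≡ id
    ⊗-∘   : ∀ {A A′ A″ B B′ B″} (f′ : Hom A′ A″) (f : Hom A A′)
              (g′ : Hom B′ B″) (g : Hom B B′) →
            (f′ ∘ f) ⊗₁ (g′ ∘ g) ≡ (f′ ⊗₁ g′) ∘ (f ⊗₁ g)
    _⧵_   : Ob → Ob → Ob
    _⧸_   : Ob → Ob → Ob
    evˡ   : ∀ {A C} → Hom (A ⊗ (A ⧵ C)) C
    evʳ   : ∀ {B C} → Hom ((C ⧸ B) ⊗ B) C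
    λc    : ∀ {A X C} → Hom (A ⊗ X) C → Hom X (A ⧵ C)
    ρc    : ∀ {X B C} → Hom (X ⊗ B) C → Hom X (C ⧸ B)
    λ-β   : ∀ {A X C} (f : Hom (A ⊗ X) C) → evˡ ∘ (id ⊗₁ λc f) ≡ f
    λ-η   : ∀ {A X C} (g : Hom X (A ⧵ C)) → λc (evˡ ∘ (id ⊗₁ g)) ≡ g
    ρ-β   : ∀ {X B C} (f : Hom (X ⊗ B) C) → evʳ ∘ (ρc f ⊗₁ id) ≡ f
    ρ-η   : ∀ {X B C} (g : Hom X (C ⧸ B)) → ρc (evʳ ∘ (g ⊗₁ id)) ≡ g

-- A type refinement system p : E → I, presented as a displayed category
-- over I: Ob[ A ] are the e-types S ⊏ A, and Hom[ f ] S T are the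
-- derivations of S ⇒_f T (morphisms α of E with p(α) = f).

record Displayed {o h : Level} (I : Category o h) (e d : Level)
       : Set (o ⊔ h ⊔ lsuc (e ⊔ d)) where
  open Category I
  infixr 9 _∘′_
  field
    Ob[_]  : Ob → Set e
    Hom[_] : ∀ {A B} → Hom A B → Ob[ A ] → Ob[ B ] → Set d
    id′    : ∀ {A} {S : Ob[ A ]} → Hom[ id ] S S
    _∘′_   : ∀ {A B C} {g : Hom B C} {f : Hom A B}
               {S : Ob[ A ]} {T : Ob[ B ]} {U : Ob[ C ]} →
             Hom[ g ] T U → Hom[ f ] S T → Hom[ g ∘ f ] S U
    idˡ′   : ∀ {A B} {f : Hom A B} {S T} (α : Hom[ f ] S T) →
             PathOver (λ k → Hom[ k ] S T) (idˡ f) (id′ ∘′ α) α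
    idʳ′   : ∀ {A B} {f : Hom A B} {S T} (α : Hom[ f ] S T) →
             PathOver (λ k → Hom[ k ] S T) (idʳ f) (α ∘′ id′) α
    assoc′ : ∀ {A B C D} {h : Hom C D} {g : Hom B C} {f : Hom A B}
               {S T U V} (γ : Hom[ h ] U V) (β : Hom[ g ] T U) (α : Hom[ f ] S T) →
             PathOver (λ k → Hom[ k ] S V) (assoc h g f)
               ((γ ∘′ β) ∘′ α) (γ ∘′ (β ∘′ α))

  _≤_ : ∀ {A} → Ob[ A ] → Ob[ A ] → Set d
  S ≤ T = Hom[ id ] S T

  record VIso {A} (S T : Ob[ A ]) : Set d where
    field
      to    : S ≤ T
      from  : T ≤ S
      to∘from : PathOver (λ k → Hom[ k ] T T) (idˡ id) (to ∘′ from) id′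
      from∘to : PathOver (λ k → Hom[ k ] S S) (idˡ id) (from ∘′ to) id′

record MonoidalClosedBifibration {o h : Level} {I : Category o h}
       (M : ClosedTensor I) (e d : Level) : Set (o ⊔ h ⊔ lsuc (e ⊔ d)) where
  open Category I
  open ClosedTensor M
  field
    D : Displayed I e d
  open Displayed D public
  infixr 10 _⊗′_ _⊗₁′_
  field
    pull      : ∀ {A B} → Hom A B → Ob[ B ] → Ob[ A ]
    cart      : ∀ {A B} {f : Hom A B} {T : Ob[ B ]} → Hom[ f ] (pull f T) T
    cart-fill : ∀ {X A B} {f : Hom A B} {g : Hom X A} {S : Ob[ X ]} {T : Ob[ B ]} →
                Hom[ f ∘ g ] S T → Hom[ g ] S (pull f T)
    cart-β    : ∀ {X A B} {f : Hom A B} {g : Hom X A} {S : Ob[ X ]} {T : Ob[ B ]}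
                  (β : Hom[ f ∘ g ] S T) → cart ∘′ cart-fill β ≡ β
    cart-η    : ∀ {X A B} {f : Hom A B} {g : Hom X A} {S : Ob[ X ]} {T : Ob[ B ]}
                  (α : Hom[ g ] S (pull f T)) → cart-fill (cart ∘′ α) ≡ α
    push        : ∀ {A B} → Hom A B → Ob[ A ] → Ob[ B ]
    opcart      : ∀ {A B} {f : Hom A B} {S : Ob[ A ]} → Hom[ f ] S (push f S)
    opcart-fill : ∀ {A B Y} {f : Hom A B} {g : Hom B Y} {S : Ob[ A ]} {U : Ob[ Y ]} →
                  Hom[ g ∘ f ] S U → Hom[ g ] (push f S) U
    opcart-β    : ∀ {A B Y} {f : Hom A B} {g : Hom B Y} {S : Ob[ A ]} {U : Ob[ Y ]}
                    (β : Hom[ g ∘ f ] S U) → opcart-fill β ∘′ opcart ≡ β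
    opcart-η    : ∀ {A B Y} {f : Hom A B} {g : Hom B Y} {S : Ob[ A ]} {U : Ob[ Y ]}
                    (α : Hom[ g ] (push f S) U) → opcart-fill (α ∘′ opcart) ≡ α
    -- p strictly preserves the tensor: S ⊗ T ⊏ A ⊗ B, functorially
    _⊗′_   : ∀ {A B} → Ob[ A ] → Ob[ B ] → Ob[ A ⊗ B ]
    _⊗₁′_  : ∀ {A A′ B B′} {f : Hom A A′} {g : Hom B B′}
               {S : Ob[ A ]} {S′ : Ob[ A′ ]} {T : Ob[ B ]} {T′ : Ob[ B′ ]} →
             Hom[ f ] S S′ → Hom[ g ] T T′ → Hom[ f ⊗₁ g ] (S ⊗′ T) (S′ ⊗′ T′)
    ⊗-id′  : ∀ {A B} {S : Ob[ A ]} {T : Ob[ B ]} →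
             PathOver (λ k → Hom[ k ] (S ⊗′ T) (S ⊗′ T)) ⊗-id (id′ {S = S} ⊗₁′ id′ {S = T}) id′
    ⊗-∘′   : ∀ {A A′ A″ B B′ B″} {f′ : Hom A′ A″} {f : Hom A A′}
               {g′ : Hom B′ B″} {g : Hom B B′} {S S′ S″ T T′ T″}
               (α′ : Hom[ f′ ] S′ S″) (α : Hom[ f ] S S′)
               (β′ : Hom[ g′ ] T′ T″) (β : Hom[ g ] T T′) →
             PathOver (λ k → Hom[ k ] (S ⊗′ T) (S″ ⊗′ T″)) (⊗-∘ f′ f g′ g)
               ((α′ ∘′ α) ⊗₁′ (β′ ∘′ β)) ((α′ ⊗₁′ β′) ∘′ (α ⊗₁′ β))
    ⊗-pull : ∀ {A A′ B B′} (f : Hom A A′) (g : Hom B B′) (S′ : Ob[ A′ ]) (T′ : Ob[ B′ ]) →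
             VIso (pull (f ⊗₁ g) (S′ ⊗′ T′)) (pull f S′ ⊗′ pull g T′)
    ⊗-push : ∀ {A A′ B B′} (f : Hom A A′) (g : Hom B B′) (S : Ob[ A ]) (T : Ob[ B ]) →
             VIso (push (f ⊗₁ g) (S ⊗′ T)) (push f S ⊗′ push g T)
    _⧵′_   : ∀ {A C} → Ob[ A ] → Ob[ C ] → Ob[ A ⧵ C ]
    _⧸′_   : ∀ {B C} → Ob[ C ] → Ob[ B ] → Ob[ C ⧸ B ]
    evˡ′   : ∀ {A C} {S : Ob[ A ]} {U : Ob[ C ]} → Hom[ evˡ ] (S ⊗′ (S ⧵′ U)) U
    evʳ′   : ∀ {B C} {T : Ob[ B ]} {U : Ob[ C ]} → Hom[ evʳ ] ((U ⧸′ T) ⊗′ T) U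
    λ′     : ∀ {A X C} {f : Hom (A ⊗ X) C} {S : Ob[ A ]} {R : Ob[ X ]} {U : Ob[ C ]} →
             Hom[ f ] (S ⊗′ R) U → Hom[ λc f ] R (S ⧵′ U)
    ρ′     : ∀ {X B C} {f : Hom (X ⊗ B) C} {R : Ob[ X ]} {T : Ob[ B ]} {U : Ob[ C ]} →
             Hom[ f ] (R ⊗′ T) U → Hom[ ρc f ] R (U ⧸′ T)
    λ-β′   : ∀ {A X C} {f : Hom (A ⊗ X) C} {S : Ob[ A ]} {R : Ob[ X ]} {U : Ob[ C ]}
               (α : Hom[ f ] (S ⊗′ R) U) →
             PathOver (λ k → Hom[ k ] (S ⊗′ R) U) (λ-β f) (evˡ′ ∘′ (id′ ⊗₁′ λ′ α)) α
    λ-η′   : ∀ {A X C} {g : Hom X (A ⧵ C)} {S : Ob[ A ]} {R : Ob[ X ]} {U : Ob[ C ]}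
               (β : Hom[ g ] R (S ⧵′ U)) →
             PathOver (λ k → Hom[ k ] R (S ⧵′ U)) (λ-η g) (λ′ (evˡ′ ∘′ (id′ ⊗₁′ β))) β
    ρ-β′   : ∀ {X B C} {f : Hom (X ⊗ B) C} {R : Ob[ X ]} {T : Ob[ B ]} {U : Ob[ C ]}
               (α : Hom[ f ] (R ⊗′ T) U) →
             PathOver (λ k → Hom[ k ] (R ⊗′ T) U) (ρ-β f) (evʳ′ ∘′ (ρ′ α ⊗₁′ id′)) α
    ρ-η′   : ∀ {X B C} {g : Hom X (C ⧸ B)} {R : Ob[ X ]} {T : Ob[ B ]} {U : Ob[ C ]}
               (β : Hom[ g ] R (U ⧸′ T)) →
             PathOver (λ k → Hom[ k ] R (U ⧸′ T)) (ρ-η g) (ρ′ (evʳ′ ∘′ (β ⊗₁′ id′))) β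

  module _ {A B C : Ob} (⊛ : Hom (A ⊗ B) C) where
    mult : Ob[ A ] → Ob[ B ] → Ob[ C ]
    mult S T = push ⊛ (S ⊗′ T)
    lres : Ob[ A ] → Ob[ C ] → Ob[ B ]
    lres S U = pull (λc ⊛) (S ⧵′ U)
    rres : Ob[ C ] → Ob[ B ] → Ob[ A ]
    rres U T = pull (ρc ⊛) (U ⧸′ T)

-- Each of the two bijections is a composite of three bijections between
-- sets of derivations, all of them read off from universal properties:
--
--   * cartesian lifting:    S ≤ f^* R        ≃  derivations S ⇒_f R,
--   * currying:             S ⇒_{ρ(⊛)} U / T ≃  S ⊗ T ⇒_⊛ U
--                           T ⇒_{λ(⊛)} S \ U ≃  S ⊗ T ⇒_⊛ U,
--   * opcartesian lifting:  S ⇒_f R          ≃  f_! S ≤ R.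
--
-- The currying bijections come from one general fact: a displayed
-- bijection lying over a bijection of base sets restricts to a bijection
-- of fibres.  This is where uniqueness of identity proofs between
-- i-expressions is needed, to identify the two base paths (β-law and
-- η-law) along which the displayed equations are transported.
module Submission where

open import Defs
open import Level using (Level)
open import Data.Product using (_×_; _,_)
open import Function.Bundles using (_↔_; mk↔ₛ′)
open import Function.Construct.Composition using (_↔-∘_)
open import Function.Construct.Symmetry using (↔-sym)
open import Relation.Binary.PropositionalEquality
  using (_≡_; refl; sym; trans; cong; subst; module ≡-Reasoning)
open import Relation.Binary.PropositionalEquality.Properties
  using (subst-∘; subst-application′)
open import Axiom.UniquenessOfIdentityProofs.WithK using (uip)

substIso : ∀ {a b} {X : Set a} (P : X → Set b) {x y : X} → x ≡ y → P x ↔ P y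
substIso P refl = mk↔ₛ′ (λ z → z) (λ z → z) (λ _ → refl) (λ _ → refl)

over-subst : ∀ {a a′ b b′} {K : Set a} {L : Set a′}
               {P : K → Set b} {Q : L → Set b′} {φ : K → L}
               (F : ∀ {k} → P k → Q (φ k)) {k k′ : K} (q : k ≡ k′) (x : P k) →
             F (subst P q x) ≡ subst Q (cong φ q) (F x)
over-subst {P = P} F q x =
  trans (sym (subst-application′ P (λ _ → F) q)) (subst-∘ q)

fibreIso : ∀ {a a′ b b′} {K : Set a} {L : Set a′}
             (P : K → Set b) (Q : L → Set b′)
             (cur : K → L) (unc : L → K)
             (β : ∀ k → unc (cur k) ≡ k) (η : ∀ l → cur (unc l) ≡ l)
             (cur′ : ∀ {k} → P k → Q (cur k)) (unc′ : ∀ {l} → Q l → P (unc l))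
             (β′ : ∀ {k} (x : P k) → subst P (β k) (unc′ (cur′ x)) ≡ x)
             (η′ : ∀ {l} (y : Q l) → subst Q (η l) (cur′ (unc′ y)) ≡ y)
             (k : K) → Q (cur k) ↔ P k
fibreIso P Q cur unc β η cur′ unc′ β′ η′ k =
  mk↔ₛ′ uncurry cur′ β′ cur∘uncurry
  where
    uncurry : Q (cur k) → P k
    uncurry y = subst P (β k) (unc′ y)

    cur∘uncurry : ∀ y → cur′ (uncurry y) ≡ y
    cur∘uncurry y = begin
      cur′ (subst P (β k) (unc′ y))             ≡⟨ over-subst cur′ (β k) (unc′ y) ⟩
      subst Q (cong cur (β k)) (cur′ (unc′ y))  ≡⟨ cong (λ r → subst Q r (cur′ (unc′ y)))
                                                        (uip (cong cur (β k)) (η (cur k))) ⟩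
      subst Q (η (cur k)) (cur′ (unc′ y))       ≡⟨ η′ y ⟩
      y                                         ∎
      where open ≡-Reasoning

module ThreeWayAdjunction {o h e d : Level} {I : Category o h} {M : ClosedTensor I}
                          (E : MonoidalClosedBifibration M e d) where
  open Category I
  open ClosedTensor M
  open MonoidalClosedBifibration E

  cartesianIso : ∀ {X A B} (f : Hom A B) (S : Ob[ X ]) (R : Ob[ B ]) {g : Hom X A} →
                 Hom[ g ] S (pull f R) ↔ Hom[ f ∘ g ] S R
  cartesianIso f S R = mk↔ₛ′ (cart ∘′_) cart-fill cart-β cart-η

  opcartesianIso : ∀ {A B Y} (f : Hom A B) (S : Ob[ A ]) (R : Ob[ Y ]) {g : Hom B Y} →
                   Hom[ g ∘ f ] S R ↔ Hom[ g ] (push f S) R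
  opcartesianIso f S R = mk↔ₛ′ opcart-fill (_∘′ opcart) opcart-η opcart-β

  ≤pull↔ : ∀ {A B} (f : Hom A B) (S : Ob[ A ]) (R : Ob[ B ]) →
           (S ≤ pull f R) ↔ Hom[ f ] S R
  ≤pull↔ f S R = substIso (λ k → Hom[ k ] S R) (idʳ f) ↔-∘ cartesianIso f S R

  push≤↔ : ∀ {A B} (f : Hom A B) (S : Ob[ A ]) (R : Ob[ B ]) →
           Hom[ f ] S R ↔ (push f S ≤ R)
  push≤↔ f S R = opcartesianIso f S R ↔-∘ substIso (λ k → Hom[ k ] S R) (sym (idˡ f))

  rightCurryIso : ∀ {A B C} (⊛ : Hom (A ⊗ B) C) (S : Ob[ A ]) (T : Ob[ B ]) (U : Ob[ C ]) →
                  Hom[ ρc ⊛ ] S (U ⧸′ T) ↔ Hom[ ⊛ ] (S ⊗′ T) U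
  rightCurryIso ⊛ S T U =
    fibreIso (λ k → Hom[ k ] (S ⊗′ T) U) (λ k → Hom[ k ] S (U ⧸′ T))
             ρc (λ g → evʳ ∘ (g ⊗₁ id)) ρ-β ρ-η
             ρ′ (λ β → evʳ′ ∘′ (β ⊗₁′ id′)) ρ-β′ ρ-η′ ⊛

  leftCurryIso : ∀ {A B C} (⊛ : Hom (A ⊗ B) C) (S : Ob[ A ]) (T : Ob[ B ]) (U : Ob[ C ]) →
                 Hom[ λc ⊛ ] T (S ⧵′ U) ↔ Hom[ ⊛ ] (S ⊗′ T) U
  leftCurryIso ⊛ S T U =
    fibreIso (λ k → Hom[ k ] (S ⊗′ T) U) (λ k → Hom[ k ] T (S ⧵′ U))
             λc (λ g → evˡ ∘ (id ⊗₁ g)) λ-β λ-η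
             λ′ (λ β → evˡ′ ∘′ (id′ ⊗₁′ β)) λ-β′ λ-η′ ⊛

  rres↔mult : ∀ {A B C} (⊛ : Hom (A ⊗ B) C) (S : Ob[ A ]) (T : Ob[ B ]) (U : Ob[ C ]) →
              (S ≤ rres ⊛ U T) ↔ (mult ⊛ S T ≤ U)
  rres↔mult ⊛ S T U =
    push≤↔ ⊛ (S ⊗′ T) U ↔-∘ (rightCurryIso ⊛ S T U ↔-∘ ≤pull↔ (ρc ⊛) S (U ⧸′ T))

  lres↔mult : ∀ {A B C} (⊛ : Hom (A ⊗ B) C) (S : Ob[ A ]) (T : Ob[ B ]) (U : Ob[ C ]) →
              (T ≤ lres ⊛ S U) ↔ (mult ⊛ S T ≤ U)
  lres↔mult ⊛ S T U =
    push≤↔ ⊛ (S ⊗′ T) U ↔-∘ (leftCurryIso ⊛ S T U ↔-∘ ≤pull↔ (λc ⊛) T (S ⧵′ U))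

mainTheorem8 : ∀ {o h e d : Level} {I : Category o h} {M : ClosedTensor I}
                 (E : MonoidalClosedBifibration M e d) →
               let open Category I
                   open ClosedTensor M
                   open MonoidalClosedBifibration E
               in ∀ {A B C : Ob} (⊛ : Hom (A ⊗ B) C)
                    (S : Ob[ A ]) (T : Ob[ B ]) (U : Ob[ C ]) →
                  ((S ≤ rres ⊛ U T) ↔ (mult ⊛ S T ≤ U))
                  × ((mult ⊛ S T ≤ U) ↔ (T ≤ lres ⊛ S U))
mainTheorem8 E ⊛ S T U = rres↔mult ⊛ S T U , ↔-sym (lres↔mult ⊛ S T U)
  where open ThreeWayAdjunction E
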